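{- Let $G_1$ and $G_2$ be simple connected graphs, neither of which contains a well-connected vertex. Then the symmetric difference $G_1\oplus G_2$ satisfies \[ C^\xi(G_1\oplus G_2) = |E(G_1)|\,|V(G_2)|^2 + |E(G_2)|\,|V(G_1)|^2 - 4|E(G_1)|\,|E(G_2)| . \]
   Context: A vertex of a graph is well-connected if it is adjacent to all other vertices of the graph. The symmetric difference $G_1\oplus G_2$ has vertex set $V(G_1)\times V(G_2)$, with $(u_1,u_2)$ adjacent to $(v_1,v_2)$ whenever $u_1$ is adjacent to $v_1$ in $G_1$ or $u_2$ is adjacent to $v_2$ in $G_2$, but not both. For a connected graph $H$, $d_H(v)$ is the degree of $v$, the eccentricity $\varepsilon_H(v)$ is the largest distance from $v$ to any other vertex, and the connective eccentric index is $C^\xi(H)=\sum_{v\in V(H)} \frac{d_H(v)}{\varepsilon_H(v)}$. -}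

module Defs where

open import Data.Bool using (Bool; true; false; _∧_; _∨_; _xor_; if_then_else_)
open import Data.Nat using (ℕ; zero; suc; _+_; _*_; _⊔_; _<ᵇ_)
open import Data.Fin using (Fin; toℕ; remQuot)
open import Data.List using (List; map; foldr; allFin)
open import Data.Nat.ListAction using (sum)
open import Data.Bool.ListAction using (any)
open import Data.Product using (_×_; _,_; ∃)
open import Data.Integer using (ℤ; +_)
import Data.Integer as ℤ
open import Data.Rational using (ℚ; 0ℚ; _/_)
import Data.Rational as ℚ
open import Relation.Binary.PropositionalEquality using (_≡_; _≢_)

record Graph (n : ℕ) : Set where
  field
    adj   : Fin n → Fin n → Bool
    irrefl : ∀ v → adj v v ≡ false
    sym   : ∀ u v → adj u v ≡ adj v u
open Graph public

data Walk {n : ℕ} (G : Graph n) : Fin n → Fin n → ℕ → Set where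
  here : ∀ v → Walk G v v 0
  step : ∀ {u w v k} → adj G u w ≡ true → Walk G w v k → Walk G u v (suc k)

Connected : ∀ {n} → Graph n → Set
Connected G = ∀ u v → ∃ λ k → Walk G u v k

WellConnected : ∀ {n} → Graph n → Fin n → Set
WellConnected G v = ∀ u → u ≢ v → adj G v u ≡ true

HasWellConnected : ∀ {n} → Graph n → Set
HasWellConnected {n} G = ∃ λ v → WellConnected G v

ind : Bool → ℕ
ind true = 1
ind false = 0

deg : ∀ {n} → Graph n → Fin n → ℕ
deg {n} G v = sum (map (λ u → ind (adj G v u)) (allFin n))

-- number of edges: unordered pairs {u,v} (counted once via toℕ u < toℕ v)
edges : ∀ {n} → Graph n → ℕ
edges {n} G = sum (map (λ u → sum (map (λ v → ind ((toℕ u <ᵇ toℕ v) ∧ adj G u v)) (allFin n))) (allFin n))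

-- reach k u v = true iff there is a walk from u to v of length at most k
reach : ∀ {n} → Graph n → ℕ → Fin n → Fin n → Bool
reach {n} G zero u v = ind-eq u v
  where
    ind-eq : Fin n → Fin n → Bool
    ind-eq a b = toℕ a Data.Nat.≡ᵇ toℕ b
reach {n} G (suc k) u v = reach G k u v ∨ any (λ w → reach G k u w ∧ adj G w v) (allFin n)

-- distance: least k (searching k = 0,1,...,n) with a walk of length ≤ k
-- (for a connected graph on n vertices the shortest-path length is < n, so
--  the fallback value is never used)
dist : ∀ {n} → Graph n → Fin n → Fin n → ℕ
dist {n} G u v = search 0 (suc n)
  where
    search : ℕ → ℕ → ℕ
    search k zero = k
    search k (suc fuel) = if reach G k u v then k else search (suc k) fuel

ecc : ∀ {n} → Graph n → Fin n → ℕ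
ecc {n} G v = foldr _⊔_ 0 (map (dist G v) (allFin n))

-- a / b as a rational (b = 0 gives 0; never occurs for the graphs considered)
frac : ℕ → ℕ → ℚ
frac a zero = 0ℚ
frac a (suc b) = (+ a) / suc b

Cξ : ∀ {n} → Graph n → ℚ
Cξ {n} G = foldr ℚ._+_ 0ℚ (map (λ v → frac (deg G v) (ecc G v)) (allFin n))

-- symmetric difference G₁ ⊕ G₂ on V(G₁) × V(G₂), encoded as Fin (n₁ * n₂)
-- via the bijection remQuot
symDiff : ∀ {n₁ n₂} → Graph n₁ → Graph n₂ → Graph (n₁ * n₂)
symDiff {n₁} {n₂} G₁ G₂ = record
  { adj = λ x y → go (remQuot n₂ x) (remQuot n₂ y)
  ; irrefl = λ x → irr (remQuot n₂ x)
  ; sym = λ x y → sy (remQuot n₂ x) (remQuot n₂ y)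
  }
  where
    go : Fin n₁ × Fin n₂ → Fin n₁ × Fin n₂ → Bool
    go (u₁ , u₂) (v₁ , v₂) = adj G₁ u₁ v₁ xor adj G₂ u₂ v₂
    irr : ∀ p → go p p ≡ false
    irr (u₁ , u₂) rewrite irrefl G₁ u₁ | irrefl G₂ u₂ = Relation.Binary.PropositionalEquality.refl
    sy : ∀ p q → go p q ≡ go q p
    sy (u₁ , u₂) (v₁ , v₂) rewrite Graph.sym G₁ u₁ v₁ | Graph.sym G₂ u₂ v₂ = Relation.Binary.PropositionalEquality.refl

ℤ→ℚ : ℤ → ℚ
ℤ→ℚ z = z / 1

module Submission where

-- If neither factor has a well-connected vertex, then every vertex of a
-- connected factor has a neighbour and a non-neighbour.  From this one checks
-- that any two vertices of G₁ ⊕ G₂ are joined by a walk of length one or two,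
-- and that every vertex (u₁,u₂) has a non-neighbour (z,u₂); hence every vertex of
-- G₁ ⊕ G₂ has eccentricity exactly 2 and Cξ(G₁ ⊕ G₂) is half its degree sum.
-- The degree sum is counted coordinatewise: since [a xor b] = [a] + [b] - 2[a][b],
-- summing over all pairs of vertices gives
--   Σ deg_⊕ + 2·D₁·D₂ = n₂²·D₁ + n₁²·D₂      (Dᵢ the degree sum of Gᵢ),
-- and the handshake lemma Dᵢ = 2|E(Gᵢ)| turns half of this into the claimed formula.

open import Defs
open import Data.Nat using (ℕ; zero; suc; _*_; _+_; _≤_; _<_; _⊔_; _<ᵇ_; z≤n; s≤s)
import Data.Nat.Properties as ℕ
import Data.Nat.ListAction as List
open import Data.Nat.Tactic.RingSolver using () renaming (solve-∀ to ℕ-solve)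
open import Data.Integer using (+_; _-_)
import Data.Integer as ℤ
import Data.Integer.Properties as ℤ
open import Data.Integer.Tactic.RingSolver using () renaming (solve-∀ to ℤ-solve)
open import Data.Rational using (_/_; 0ℚ)
import Data.Rational as ℚ
open import Data.Rational.Properties using (toℚᵘ-injective; toℚᵘ-fromℚᵘ; toℚᵘ-homo-+; 0/n≡0)
open import Data.Rational.Unnormalised using (mkℚᵘ; *≡*)
open import Data.Rational.Unnormalised.Properties using (≃-trans; ≃-sym; +-cong)
open import Data.Bool using (Bool; true; false; T; _∧_; _∨_; _xor_; if_then_else_)
import Data.Bool as Bool
open import Data.Bool.Properties using (T-≡; ¬-not; ∧-zeroʳ; ∨-zeroʳ)
open import Data.Bool.ListAction using (any)
open import Data.Fin using (Fin; zero; suc; toℕ; combine; _↑ˡ_; _↑ʳ_; _≟_)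
open import Data.Fin.Properties
  using (toℕ-injective; combine-injectiveˡ; combine-surjective; remQuot-combine; ¬∀⟶∃¬)
open import Data.List using ([]; _∷_; map; foldr; allFin; tabulate)
open import Data.List.Membership.Propositional using (_∈_)
open import Data.List.Membership.Propositional.Properties using (∈-allFin)
open import Data.List.Relation.Unary.Any using (here; there)
open import Data.Product using (_×_; _,_; ∃; proj₁; proj₂)
open import Data.Sum using (_⊎_; inj₁; inj₂)
open import Data.Empty using (⊥-elim)
open import Function using (_∘_; id)
open import Function.Bundles using (Equivalence)
open import Relation.Nullary using (¬_; yes; no; ¬?)
open import Relation.Nullary.Decidable using (_→-dec_)
open import Relation.Binary.PropositionalEquality as ≡
  using (_≡_; _≢_; refl; cong; cong₂; trans; subst)
open ≡.≡-Reasoning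
open import Algebra.Properties.Semiring.Sum ℕ.+-*-semiring
  using (sum; sum-syntax; ∑-distrib-+; ∑-comm; sum-cong-≗; *-distribˡ-sum; *-distribʳ-sum)

sum-tabulate : ∀ {A : Set} {n} (g : Fin n → A) (f : A → ℕ) →
  List.sum (map f (tabulate g)) ≡ ∑[ i < n ] f (g i)
sum-tabulate {n = zero} g f = refl
sum-tabulate {n = suc n} g f = cong (_+_ (f (g zero))) (sum-tabulate (g ∘ suc) f)

sum-allFin : ∀ {n} (f : Fin n → ℕ) → List.sum (map f (allFin n)) ≡ ∑[ i < n ] f i
sum-allFin f = sum-tabulate id f

sum-const : ∀ n c → ∑[ i < n ] c ≡ n * c
sum-const zero c = refl
sum-const (suc n) c = cong (_+_ c) (sum-const n c)

sum-↑ : ∀ a {b} (f : Fin (a + b) → ℕ) →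
  ∑[ x < a + b ] f x ≡ ∑[ i < a ] f (i ↑ˡ b) + ∑[ j < b ] f (a ↑ʳ j)
sum-↑ zero f = refl
sum-↑ (suc a) f = trans (cong (_+_ (f zero)) (sum-↑ a (f ∘ suc))) (≡.sym (ℕ.+-assoc (f zero) _ _))

sum-combine : ∀ m {n} (f : Fin (m * n) → ℕ) →
  ∑[ x < m * n ] f x ≡ ∑[ i < m ] ∑[ j < n ] f (combine i j)
sum-combine zero f = refl
sum-combine (suc m) {n} f =
  trans (sum-↑ n f) (cong (_+_ (∑[ j < n ] f (j ↑ˡ m * n))) (sum-combine m (f ∘ (n ↑ʳ_))))

∑∑-distrib-+ : ∀ {a b} (h k : Fin a → Fin b → ℕ) →
  ∑[ i < a ] ∑[ j < b ] (h i j + k i j) ≡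
  ∑[ i < a ] ∑[ j < b ] h i j + ∑[ i < a ] ∑[ j < b ] k i j
∑∑-distrib-+ h k =
  trans (sum-cong-≗ (λ i → ∑-distrib-+ (h i) (k i))) (∑-distrib-+ (λ i → sum (h i)) (λ i → sum (k i)))

∑∑-product : ∀ {a b} c (f : Fin a → ℕ) (g : Fin b → ℕ) →
  ∑[ i < a ] ∑[ j < b ] (c * (f i * g j)) ≡ c * (sum f * sum g)
∑∑-product {a} {b} c f g = ≡.sym (begin
  c * (sum f * sum g)
    ≡⟨ cong (c *_) (*-distribʳ-sum (sum g) f) ⟩
  c * ∑[ i < a ] (f i * sum g)
    ≡⟨ cong (c *_) (sum-cong-≗ (λ i → *-distribˡ-sum (f i) g)) ⟩
  c * ∑[ i < a ] ∑[ j < b ] (f i * g j)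
    ≡⟨ *-distribˡ-sum c (λ i → ∑[ j < b ] (f i * g j)) ⟩
  ∑[ i < a ] (c * ∑[ j < b ] (f i * g j))
    ≡⟨ sum-cong-≗ (λ i → *-distribˡ-sum c (λ j → f i * g j)) ⟩
  ∑[ i < a ] ∑[ j < b ] (c * (f i * g j)) ∎)

sum-separable : ∀ {a b} (h : Fin a → Fin b → ℕ) (f u : Fin a → ℕ) (g w : Fin b → ℕ) c →
  (∀ i j → h i j + c * (f i * g j) ≡ u i + w j) →
  ∑[ i < a ] ∑[ j < b ] h i j + c * (sum f * sum g) ≡ b * sum u + a * sum w
sum-separable {a} {b} h f u g w c pointwise = begin
  ∑[ i < a ] ∑[ j < b ] h i j + c * (sum f * sum g)
    ≡⟨ cong (_+_ (∑[ i < a ] ∑[ j < b ] h i j)) (≡.sym (∑∑-product c f g)) ⟩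
  ∑[ i < a ] ∑[ j < b ] h i j + ∑[ i < a ] ∑[ j < b ] (c * (f i * g j))
    ≡⟨ ≡.sym (∑∑-distrib-+ h (λ i j → c * (f i * g j))) ⟩
  ∑[ i < a ] ∑[ j < b ] (h i j + c * (f i * g j))
    ≡⟨ sum-cong-≗ (λ i → sum-cong-≗ (pointwise i)) ⟩
  ∑[ i < a ] ∑[ j < b ] (u i + w j)
    ≡⟨ ∑∑-distrib-+ (λ i _ → u i) (λ _ j → w j) ⟩
  ∑[ i < a ] ∑[ j < b ] u i + ∑[ i < a ] ∑[ j < b ] w j
    ≡⟨ cong₂ _+_ (sum-cong-≗ (λ i → sum-const b (u i))) (sum-const a (sum w)) ⟩
  ∑[ i < a ] (b * u i) + a * sum w
    ≡⟨ cong (_+ a * sum w) (≡.sym (*-distribˡ-sum b u)) ⟩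
  b * sum u + a * sum w ∎

/-cross : ∀ (p q : ℤ.ℤ) m n → p ℤ.* + suc n ≡ q ℤ.* + suc m → p / suc m ≡ q / suc n
/-cross p q m n eq = toℚᵘ-injective
  (≃-trans (toℚᵘ-fromℚᵘ (mkℚᵘ p m)) (≃-trans (*≡* eq) (≃-sym (toℚᵘ-fromℚᵘ (mkℚᵘ q n)))))

/-+ : ∀ p q d → p / suc d ℚ.+ q / suc d ≡ (p ℤ.+ q) / suc d
/-+ p q d = toℚᵘ-injective
  (≃-trans (toℚᵘ-homo-+ (p / suc d) (q / suc d))
  (≃-trans (+-cong (toℚᵘ-fromℚᵘ (mkℚᵘ p d)) (toℚᵘ-fromℚᵘ (mkℚᵘ q d)))
  (≃-trans (*≡* cross) (≃-sym (toℚᵘ-fromℚᵘ (mkℚᵘ (p ℤ.+ q) d))))))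
  where
  factor : ∀ x y z → (x ℤ.* z ℤ.+ y ℤ.* z) ℤ.* z ≡ (x ℤ.+ y) ℤ.* (z ℤ.* z)
  factor = ℤ-solve
  cross : (p ℤ.* + suc d ℤ.+ q ℤ.* + suc d) ℤ.* + suc d ≡ (p ℤ.+ q) ℤ.* + (suc d * suc d)
  cross = trans (factor p q (+ suc d)) (cong ((p ℤ.+ q) ℤ.*_) (≡.sym (ℤ.pos-* (suc d) (suc d))))

half-of-difference : ∀ s a b → s + 2 * b ≡ 2 * a → (+ s) / 2 ≡ ℤ→ℚ (+ a - + b)
half-of-difference s a b e = /-cross (+ s) (+ a - + b) 1 0 (begin
  + s ℤ.* + 1                         ≡⟨ cancel (+ s) (+ (2 * b)) ⟩
  (+ s ℤ.+ + (2 * b)) - + (2 * b)      ≡⟨ cong (_- + (2 * b)) (≡.sym (ℤ.pos-+ s (2 * b))) ⟩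
  + (s + 2 * b) - + (2 * b)            ≡⟨ cong (λ t → + t - + (2 * b)) e ⟩
  + (2 * a) - + (2 * b)                ≡⟨ cong₂ _-_ (ℤ.pos-* 2 a) (ℤ.pos-* 2 b) ⟩
  + 2 ℤ.* + a - + 2 ℤ.* + b            ≡⟨ factor (+ 2) (+ a) (+ b) ⟩
  (+ a - + b) ℤ.* + 2                 ∎)
  where
  cancel : ∀ x y → x ℤ.* + 1 ≡ (x ℤ.+ y) - y
  cancel = ℤ-solve
  factor : ∀ z x y → z ℤ.* x - z ℤ.* y ≡ (x - y) ℤ.* z
  factor = ℤ-solve

degree-sum : ∀ {n} → Graph n → ℕ
degree-sum {n} G = ∑[ v < n ] deg G v

deg-∑ : ∀ {n} (G : Graph n) u → deg G u ≡ ∑[ v < n ] ind (adj G u v)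
deg-∑ G u = sum-allFin (λ v → ind (adj G u v))

forward : ∀ {n} → Graph n → Fin n → Fin n → ℕ
forward G u v = ind ((toℕ u <ᵇ toℕ v) ∧ adj G u v)

ind-adj-split : ∀ {n} (G : Graph n) u v → ind (adj G u v) ≡ forward G u v + forward G v u
ind-adj-split G u v with toℕ u <ᵇ toℕ v in u<v | toℕ v <ᵇ toℕ u in v<u
... | true  | true  = ⊥-elim (ℕ.<-asym (lt (toℕ u) (toℕ v) u<v) (lt (toℕ v) (toℕ u) v<u))
  where
  lt : ∀ m n → (m <ᵇ n) ≡ true → m < n
  lt m n e = ℕ.<ᵇ⇒< m n (Equivalence.from T-≡ e)
... | true  | false = ≡.sym (ℕ.+-identityʳ _)
... | false | true  = cong ind (sym G u v)
... | false | false = cong ind (subst (λ w → adj G u w ≡ false) u≡v (irrefl G u))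
  where
  ≮ : ∀ {m n} → (m <ᵇ n) ≡ false → ¬ (m < n)
  ≮ e lt = subst T e (ℕ.<⇒<ᵇ lt)
  u≡v = toℕ-injective (ℕ.≤-antisym (ℕ.≮⇒≥ (≮ v<u)) (ℕ.≮⇒≥ (≮ u<v)))

-- Handshake lemma: splitting every adjacency by the order of its ends, the
-- degree sum counts each edge once from each end.
handshake : ∀ {n} (G : Graph n) → degree-sum G ≡ 2 * edges G
handshake {n} G = begin
  ∑[ u < n ] deg G u                                  ≡⟨ sum-cong-≗ (deg-∑ G) ⟩
  ∑[ u < n ] ∑[ v < n ] ind (adj G u v)               ≡⟨ sum-cong-≗ (λ u → sum-cong-≗ (ind-adj-split G u)) ⟩
  ∑[ u < n ] ∑[ v < n ] (forward G u v + forward G v u)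
    ≡⟨ ∑∑-distrib-+ (forward G) (λ u v → forward G v u) ⟩
  E + ∑[ u < n ] ∑[ v < n ] forward G v u             ≡⟨ cong (_+_ E) (∑-comm (λ u v → forward G v u)) ⟩
  E + E                                               ≡⟨ cong (λ t → t + t) (≡.sym edges-∑) ⟩
  edges G + edges G                                   ≡⟨ cong (_+_ (edges G)) (≡.sym (ℕ.+-identityʳ _)) ⟩
  2 * edges G                                         ∎
  where
  E = ∑[ u < n ] ∑[ v < n ] forward G u v
  edges-∑ : edges G ≡ E
  edges-∑ = trans (sum-allFin (λ u → List.sum (map (forward G u) (allFin n))))
                  (sum-cong-≗ (λ u → sum-allFin (forward G u)))

any-witness : ∀ {A : Set} (f : A → Bool) {x xs} → x ∈ xs → f x ≡ true → any f xs ≡ true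
any-witness f {xs = y ∷ ys} (here refl) fx = cong (_∨ any f ys) fx
any-witness f {xs = y ∷ ys} (there x∈ys) fx = trans (cong (f y ∨_) (any-witness f x∈ys fx)) (∨-zeroʳ (f y))

any-none : ∀ {A : Set} (f : A → Bool) xs → (∀ x → f x ≡ false) → any f xs ≡ false
any-none f [] none = refl
any-none f (x ∷ xs) none = cong₂ _∨_ (none x) (any-none f xs none)

max-≤ : ∀ {A : Set} (f : A → ℕ) xs c → (∀ x → f x ≤ c) → foldr _⊔_ 0 (map f xs) ≤ c
max-≤ f [] c bound = z≤n
max-≤ f (x ∷ xs) c bound = ℕ.⊔-lub (bound x) (max-≤ f xs c bound)

≤-max : ∀ {A : Set} (f : A → ℕ) {x xs} → x ∈ xs → f x ≤ foldr _⊔_ 0 (map f xs)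
≤-max f (here refl) = ℕ.m≤m⊔n _ _
≤-max f (there x∈xs) = ℕ.≤-trans (≤-max f x∈xs) (ℕ.m≤n⊔m _ _)

-- The first three rounds of the search defining dist, with the value e of the rest.
firstThree : Bool → Bool → Bool → ℕ → ℕ
firstThree b₀ b₁ b₂ e = if b₀ then 0 else if b₁ then 1 else if b₂ then 2 else e

-- On one vertex the search stops after two rounds with fallback 2, which
-- agrees with a third round; on two or more vertices there are three rounds.
dist-unfold : ∀ {n} (G : Graph n) u v → ∃ λ e → dist G u v ≡ firstThree (reach G 0 u v) (reach G 1 u v) (reach G 2 u v) e
dist-unfold {suc zero} G u v =
  2 , cong (λ t → if reach G 0 u v then 0 else if reach G 1 u v then 1 else t) (≡.sym (if-const (reach G 2 u v)))
  where
  if-const : ∀ b → (if b then 2 else 2) ≡ 2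
  if-const true = refl
  if-const false = refl
dist-unfold {suc (suc n)} G u v = _ , refl

module _ {n} (G : Graph n) where

  reach-refl : ∀ u → reach G 0 u u ≡ true
  reach-refl u = Equivalence.to T-≡ (ℕ.≡⇒≡ᵇ (toℕ u) (toℕ u) refl)

  reach-≢ : ∀ {u v} → u ≢ v → reach G 0 u v ≡ false
  reach-≢ {u} {v} u≢v = ¬-not (λ e → u≢v (toℕ-injective (ℕ.≡ᵇ⇒≡ (toℕ u) (toℕ v) (Equivalence.from T-≡ e))))

  reach-suc : ∀ k u {v} → reach G k u v ≡ true → reach G (suc k) u v ≡ true
  reach-suc k u {v} r = cong (_∨ any (λ w → reach G k u w ∧ adj G w v) (allFin n)) r

  reach-step : ∀ k u {w v} → reach G k u w ≡ true → adj G w v ≡ true → reach G (suc k) u v ≡ true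
  reach-step k u {w} {v} r a = trans
    (cong (reach G k u v ∨_) (any-witness (λ w′ → reach G k u w′ ∧ adj G w′ v) (∈-allFin w) (cong₂ _∧_ r a)))
    (∨-zeroʳ _)

  reach-1-non-neighbour : ∀ {u v} → u ≢ v → adj G u v ≡ false → reach G 1 u v ≡ false
  reach-1-non-neighbour {u} {v} u≢v a = cong₂ _∨_ (reach-≢ u≢v) (any-none _ (allFin n) none)
    where
    none : ∀ w → reach G 0 u w ∧ adj G w v ≡ false
    none w with w ≟ u
    ... | yes refl = trans (cong (reach G 0 u u ∧_) a) (∧-zeroʳ _)
    ... | no w≢u   = cong (_∧ adj G w v) (reach-≢ (w≢u ∘ ≡.sym))

  WithinTwo : Fin n → Fin n → Set
  WithinTwo u v = adj G u v ≡ true ⊎ ∃ λ w → adj G u w ≡ true × adj G w v ≡ true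

  withinTwo-reach : ∀ {u v} → WithinTwo u v → reach G 2 u v ≡ true
  withinTwo-reach {u} (inj₁ a) = reach-suc 1 u (reach-step 0 u (reach-refl u) a)
  withinTwo-reach {u} (inj₂ (w , a , b)) = reach-step 1 u (reach-step 0 u (reach-refl u) a) b

  firstThree-≤2 : ∀ b₀ b₁ {b₂} e → b₂ ≡ true → firstThree b₀ b₁ b₂ e ≤ 2
  firstThree-≤2 true  b₁    e r = z≤n
  firstThree-≤2 false true  e r = s≤s z≤n
  firstThree-≤2 false false e refl = ℕ.≤-refl

  dist-≤2 : ∀ u v → reach G 2 u v ≡ true → dist G u v ≤ 2
  dist-≤2 u v r with dist-unfold G u v
  ... | e , eq = subst (_≤ 2) (≡.sym eq) (firstThree-≤2 (reach G 0 u v) (reach G 1 u v) e r)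

  dist-≡2 : ∀ u v → reach G 0 u v ≡ false → reach G 1 u v ≡ false → reach G 2 u v ≡ true → dist G u v ≡ 2
  dist-≡2 u v r₀ r₁ r₂ with dist-unfold G u v
  ... | e , eq rewrite r₀ | r₁ | r₂ = eq

  ecc-exact : ∀ u d → (∀ v → dist G u v ≤ d) → (∃ λ v → dist G u v ≡ d) → ecc G u ≡ d
  ecc-exact u d bound (v , attained) = ℕ.≤-antisym (max-≤ (dist G u) (allFin n) d bound)
    (subst (_≤ ecc G u) attained (≤-max (dist G u) (∈-allFin v)))

  ecc-two : ∀ u → (∀ v → WithinTwo u v) → (∃ λ v → u ≢ v × adj G u v ≡ false) → ecc G u ≡ 2
  ecc-two u near (v , u≢v , a) = ecc-exact u 2
    (λ w → dist-≤2 u w (withinTwo-reach (near w)))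
    (v , dist-≡2 u v (reach-≢ u≢v) (reach-1-non-neighbour u≢v a) (withinTwo-reach (near v)))

HasNeighbours : ∀ {n} → Graph n → Set
HasNeighbours G = ∀ u → ∃ λ w → adj G u w ≡ true

HasNonNeighbours : ∀ {n} → Graph n → Set
HasNonNeighbours G = ∀ u → ∃ λ z → z ≢ u × adj G u z ≡ false

-- Not being well-connected is witnessed by a vertex, adjacency being decidable.
non-neighbours : ∀ {n} (G : Graph n) → ¬ HasWellConnected G → HasNonNeighbours G
non-neighbours {n} G noWC u with ¬∀⟶∃¬ n (λ z → z ≢ u → adj G u z ≡ true)
  (λ z → ¬? (z ≟ u) →-dec (adj G u z Bool.≟ true)) (λ wc → noWC (u , wc))
... | z , ¬adj = z , (λ z≡u → ¬adj (λ z≢u → ⊥-elim (z≢u z≡u))) , ¬-not (λ a → ¬adj (λ _ → a))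

first-edge : ∀ {n} {G : Graph n} {u z k} → Walk G u z k → z ≢ u → ∃ λ w → adj G u w ≡ true
first-edge (here _) z≢u = ⊥-elim (z≢u refl)
first-edge (step {w = w} a _) _ = w , a

neighbours : ∀ {n} (G : Graph n) → Connected G → HasNonNeighbours G → HasNeighbours G
neighbours G conn nonNb u with nonNb u
... | z , z≢u , _ = first-edge (proj₂ (conn u z)) z≢u

module SymmetricDifference {n₁ n₂} (G₁ : Graph n₁) (G₂ : Graph n₂) where

  G : Graph (n₁ * n₂)
  G = symDiff G₁ G₂

  adj-combine : ∀ i j k l → adj G (combine i j) (combine k l) ≡ adj G₁ i k xor adj G₂ j l
  adj-combine i j k l = cong₂ (λ p q → adj G₁ (proj₁ p) (proj₁ q) xor adj G₂ (proj₂ p) (proj₂ q))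
    (remQuot-combine i j) (remQuot-combine k l)

  edge : ∀ {i j k l} a b → adj G₁ i k ≡ a → adj G₂ j l ≡ b → adj G (combine i j) (combine k l) ≡ a xor b
  edge _ _ refl refl = adj-combine _ _ _ _

  by-coordinates : (P : Fin (n₁ * n₂) → Set) → (∀ i j → P (combine i j)) → ∀ x → P x
  by-coordinates P h x with combine-surjective {n₁} {n₂} x
  ... | i , j , refl = h i j

  withinTwo : HasNeighbours G₁ → HasNeighbours G₂ → ∀ x y → WithinTwo G x y
  withinTwo nb₁ nb₂ = by-coordinates _ λ u₁ u₂ → by-coordinates _ λ v₁ v₂ → coordinates u₁ u₂ v₁ v₂
    where
    via : ∀ {x y} z → adj G x z ≡ true → adj G z y ≡ true → WithinTwo G x y
    via z a b = inj₂ (z , a , b)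

    towards : ∀ v → ∃ λ x → adj G₂ x v ≡ true
    towards v with nb₂ v
    ... | x , a = x , trans (sym G₂ x v) a

    -- Both coordinate pairs non-adjacent: with x₁ ~ u₁ and x₂ ~ v₂, one of
    -- (x₁, u₂), (u₁, x₂), (x₁, x₂) is a common neighbour.
    nonadjacent : ∀ u₁ u₂ v₁ v₂ → adj G₁ u₁ v₁ ≡ false → adj G₂ u₂ v₂ ≡ false →
      WithinTwo G (combine u₁ u₂) (combine v₁ v₂)
    nonadjacent u₁ u₂ v₁ v₂ e₁ e₂ with nb₁ u₁ | towards v₂
    ... | x₁ , a₁ | x₂ , b₂ with adj G₁ x₁ v₁ in e₃ | adj G₂ u₂ x₂ in e₄
    ...   | true  | _     = via (combine x₁ u₂) (edge true false a₁ (irrefl G₂ u₂)) (edge true false e₃ e₂)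
    ...   | false | true  = via (combine u₁ x₂) (edge false true (irrefl G₁ u₁) e₄) (edge false true e₁ b₂)
    ...   | false | false = via (combine x₁ x₂) (edge true false a₁ e₄) (edge false true e₃ b₂)

    -- Exactly one coordinate pair adjacent: an edge.  Both adjacent: (u₁, v₂) is
    -- a common neighbour.
    coordinates : ∀ u₁ u₂ v₁ v₂ → WithinTwo G (combine u₁ u₂) (combine v₁ v₂)
    coordinates u₁ u₂ v₁ v₂ with adj G₁ u₁ v₁ in e₁ | adj G₂ u₂ v₂ in e₂
    ... | true  | false = inj₁ (edge true false e₁ e₂)
    ... | false | true  = inj₁ (edge false true e₁ e₂)
    ... | true  | true  = via (combine u₁ v₂) (edge false true (irrefl G₁ u₁) e₂) (edge true false e₁ (irrefl G₂ v₂))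
    ... | false | false = nonadjacent u₁ u₂ v₁ v₂ e₁ e₂

  -- A non-neighbour z of u₁ in G₁ gives the non-neighbour (z, u₂) of (u₁, u₂).
  far : HasNonNeighbours G₁ → ∀ x → ∃ λ y → x ≢ y × adj G x y ≡ false
  far nonNb₁ = by-coordinates _ λ u₁ u₂ → let (z , z≢u₁ , a) = nonNb₁ u₁ in
    combine z u₂ , (λ e → z≢u₁ (≡.sym (combine-injectiveˡ u₁ u₂ z u₂ e))) , edge false false a (irrefl G₂ u₂)

  ecc-⊕ : HasNeighbours G₁ → HasNeighbours G₂ → HasNonNeighbours G₁ → ∀ x → ecc G x ≡ 2
  ecc-⊕ nb₁ nb₂ nonNb₁ x = ecc-two G x (withinTwo nb₁ nb₂ x) (far nonNb₁ x)

  ind-xor : ∀ a b → ind (a xor b) + 2 * (ind a * ind b) ≡ ind a + ind b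
  ind-xor true  true  = refl
  ind-xor true  false = refl
  ind-xor false true  = refl
  ind-xor false false = refl

  χ : Fin n₁ → Fin n₂ → Fin n₁ → Fin n₂ → ℕ
  χ i j k l = ind (adj G₁ i k xor adj G₂ j l)

  deg-combine : ∀ i j → deg G (combine i j) ≡ ∑[ k < n₁ ] ∑[ l < n₂ ] χ i j k l
  deg-combine i j = begin
    deg G (combine i j)                                              ≡⟨ deg-∑ G (combine i j) ⟩
    ∑[ y < n₁ * n₂ ] ind (adj G (combine i j) y)                     ≡⟨ sum-combine n₁ _ ⟩
    ∑[ k < n₁ ] ∑[ l < n₂ ] ind (adj G (combine i j) (combine k l))
      ≡⟨ sum-cong-≗ (λ k → sum-cong-≗ (λ l → cong ind (adj-combine i j k l))) ⟩
    ∑[ k < n₁ ] ∑[ l < n₂ ] χ i j k l                                ∎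

  -- Degree sum of G₁ ⊕ G₂ by inclusion–exclusion: first at a fixed vertex,
  -- then summed over all vertices, both times by sum-separable.
  degree-sum-⊕ : degree-sum G + 2 * (degree-sum G₁ * degree-sum G₂) ≡
                 n₂ * (n₂ * degree-sum G₁) + n₁ * (n₁ * degree-sum G₂)
  degree-sum-⊕ = begin
    degree-sum G + 2 * (degree-sum G₁ * degree-sum G₂)
      ≡⟨ cong (_+ 2 * (degree-sum G₁ * degree-sum G₂))
           (trans (sum-combine n₁ (deg G)) (sum-cong-≗ (λ i → sum-cong-≗ (deg-combine i)))) ⟩
    ∑[ i < n₁ ] ∑[ j < n₂ ] h i j + 2 * (degree-sum G₁ * degree-sum G₂)
      ≡⟨ sum-separable h (deg G₁) (λ i → n₂ * deg G₁ i) (deg G₂) (λ j → n₁ * deg G₂ j) 2 at-vertex ⟩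
    n₂ * ∑[ i < n₁ ] (n₂ * deg G₁ i) + n₁ * ∑[ j < n₂ ] (n₁ * deg G₂ j)
      ≡⟨ cong₂ (λ s t → n₂ * s + n₁ * t)
           (≡.sym (*-distribˡ-sum n₂ (deg G₁))) (≡.sym (*-distribˡ-sum n₁ (deg G₂))) ⟩
    n₂ * (n₂ * degree-sum G₁) + n₁ * (n₁ * degree-sum G₂) ∎
    where
    h : Fin n₁ → Fin n₂ → ℕ
    h i j = ∑[ k < n₁ ] ∑[ l < n₂ ] χ i j k l

    at-vertex : ∀ i j → h i j + 2 * (deg G₁ i * deg G₂ j) ≡ n₂ * deg G₁ i + n₁ * deg G₂ j
    at-vertex i j = begin
      h i j + 2 * (deg G₁ i * deg G₂ j)
        ≡⟨ cong (λ t → h i j + 2 * t) (cong₂ _*_ (deg-∑ G₁ i) (deg-∑ G₂ j)) ⟩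
      h i j + 2 * (sum a * sum b)
        ≡⟨ sum-separable (χ i j) a a b b 2 (λ k l → ind-xor (adj G₁ i k) (adj G₂ j l)) ⟩
      n₂ * sum a + n₁ * sum b
        ≡⟨ cong₂ (λ s t → n₂ * s + n₁ * t) (≡.sym (deg-∑ G₁ i)) (≡.sym (deg-∑ G₂ j)) ⟩
      n₂ * deg G₁ i + n₁ * deg G₂ j ∎
      where
      a = λ k → ind (adj G₁ i k)
      b = λ l → ind (adj G₂ j l)

Cξ-ecc-two : ∀ {n} (G : Graph n) → (∀ v → ecc G v ≡ 2) → Cξ G ≡ (+ degree-sum G) / 2
Cξ-ecc-two {n} G ecc≡2 = trans (halves (allFin n)) (cong (λ s → (+ s) / 2) (sum-allFin (deg G)))
  where
  halves : ∀ vs → foldr ℚ._+_ 0ℚ (map (λ v → frac (deg G v) (ecc G v)) vs) ≡ (+ List.sum (map (deg G) vs)) / 2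
  halves [] = ≡.sym (0/n≡0 2)
  halves (v ∷ vs) = begin
    frac (deg G v) (ecc G v) ℚ.+ _           ≡⟨ cong₂ ℚ._+_ (cong (frac (deg G v)) (ecc≡2 v)) (halves vs) ⟩
    (+ deg G v) / 2 ℚ.+ (+ rest) / 2         ≡⟨ /-+ (+ deg G v) (+ rest) 1 ⟩
    (+ deg G v ℤ.+ + rest) / 2               ≡⟨ cong (_/ 2) (≡.sym (ℤ.pos-+ (deg G v) rest)) ⟩
    (+ (deg G v + rest)) / 2                 ∎
    where rest = List.sum (map (deg G) vs)

theorem5 : ∀ {n₁ n₂} (G₁ : Graph n₁) (G₂ : Graph n₂) →
    Connected G₁ → Connected G₂ →
    ¬ HasWellConnected G₁ → ¬ HasWellConnected G₂ →
    Cξ (symDiff G₁ G₂) ≡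
      ℤ→ℚ ((+ (edges G₁ * (n₂ * n₂) + edges G₂ * (n₁ * n₁)))
            - (+ (4 * edges G₁ * edges G₂)))
theorem5 {n₁} {n₂} G₁ G₂ conn₁ conn₂ noWC₁ noWC₂ = begin
  Cξ G                                  ≡⟨ Cξ-ecc-two G (ecc-⊕ (neighbours G₁ conn₁ nonNb₁) (neighbours G₂ conn₂ nonNb₂) nonNb₁) ⟩
  (+ degree-sum G) / 2                  ≡⟨ half-of-difference (degree-sum G) (m₁ * (n₂ * n₂) + m₂ * (n₁ * n₁)) (4 * m₁ * m₂) count ⟩
  ℤ→ℚ (+ (m₁ * (n₂ * n₂) + m₂ * (n₁ * n₁)) - + (4 * m₁ * m₂)) ∎
  where
  open SymmetricDifference G₁ G₂
  nonNb₁ = non-neighbours G₁ noWC₁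
  nonNb₂ = non-neighbours G₂ noWC₂
  m₁ = edges G₁
  m₂ = edges G₂
  count : degree-sum G + 2 * (4 * m₁ * m₂) ≡ 2 * (m₁ * (n₂ * n₂) + m₂ * (n₁ * n₁))
  count = begin
    degree-sum G + 2 * (4 * m₁ * m₂)                       ≡⟨ cong (_+_ (degree-sum G)) (regroup m₁ m₂) ⟩
    degree-sum G + 2 * (2 * m₁ * (2 * m₂))
      ≡⟨ cong (λ t → degree-sum G + 2 * t) (≡.sym (cong₂ _*_ (handshake G₁) (handshake G₂))) ⟩
    degree-sum G + 2 * (degree-sum G₁ * degree-sum G₂)     ≡⟨ degree-sum-⊕ ⟩
    n₂ * (n₂ * degree-sum G₁) + n₁ * (n₁ * degree-sum G₂)
      ≡⟨ cong₂ (λ d₁ d₂ → n₂ * (n₂ * d₁) + n₁ * (n₁ * d₂)) (handshake G₁) (handshake G₂) ⟩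
    n₂ * (n₂ * (2 * m₁)) + n₁ * (n₁ * (2 * m₂))            ≡⟨ rearrange n₁ n₂ m₁ m₂ ⟩
    2 * (m₁ * (n₂ * n₂) + m₂ * (n₁ * n₁))                  ∎
    where
    regroup : ∀ m k → 2 * (4 * m * k) ≡ 2 * (2 * m * (2 * k))
    regroup = ℕ-solve
    rearrange : ∀ p q m k → q * (q * (2 * m)) + p * (p * (2 * k)) ≡ 2 * (m * (q * q) + k * (p * p))
    rearrange = ℕ-solve
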